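{- Let $D_1$ and $D_2$ be oriented graphs such that $\mathrm{inv}(D_1) = \mathrm{inv}(D_2) \ge 1$. Then $\mathrm{inv}(D_1 \rightarrow D_2) > \mathrm{inv}(D_1)$.
   Context: An oriented graph is a simple directed graph with no loops and at most one of the edges $uv$, $vu$ for each pair of distinct vertices $u,v$. For an oriented graph $D$ and $X\subseteq V(D)$, inverting $X$ means reversing the orientation of every edge with both endpoints in $X$. Inverting a family $X_1,\dots,X_k$ means inverting each set in turn. The inversion number $\mathrm{inv}(D)$ is the minimum $k$ such that some family $X_1,\dots,X_k\subseteq V(D)$, when inverted, yields an acyclic oriented graph. For oriented graphs $D_1,D_2$, the dijoin $D_1\rightarrow D_2$ is the oriented graph formed from vertex-disjoint copies of $D_1$ and $D_2$ by adding all edges $uv$ with $u\in V(D_1)$ and $v\in V(D_2)$. -}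

module Defs where

open import Data.Nat using (ℕ; zero; suc; _+_; _≤_; _<_)
open import Data.Fin using (Fin; splitAt)
open import Data.Bool using (Bool; true; false; if_then_else_; _∧_)
open import Data.Sum using (_⊎_; inj₁; inj₂)
open import Data.Product using (_×_; Σ; ∃; _,_)
open import Data.Vec using (Vec; []; _∷_)
open import Data.Empty using (⊥)
open import Relation.Nullary using (¬_)
open import Relation.Binary.PropositionalEquality using (_≡_)

-- A digraph on vertex set Fin n: Adj u v ≡ true iff there is an edge u → v.
Digraph : ℕ → Set
Digraph n = Fin n → Fin n → Bool

record OrientedGraph : Set where
  field
    size    : ℕ
    adj     : Digraph size
    noLoop  : ∀ u → adj u u ≡ false
    antisym : ∀ u v → adj u v ≡ true → adj v u ≡ false
open OrientedGraph public

VSubset : ℕ → Set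
VSubset n = Fin n → Bool

invert : ∀ {n} → VSubset n → Digraph n → Digraph n
invert X E u v = if X u ∧ X v then E v u else E u v

invertAll : ∀ {n k} → Vec (VSubset n) k → Digraph n → Digraph n
invertAll []       E = E
invertAll (X ∷ Xs) E = invertAll Xs (invert X E)

-- Successor modulo (k+1) on Fin (suc k), used to close a cycle.
open import Data.Fin using (zero; suc; fromℕ; inject₁)
next : ∀ {k} → Fin (suc k) → Fin (suc k)
next {zero}  zero    = zero
next {suc k} zero    = suc zero
next {suc k} (suc i) with next {k} i
... | zero   = zero
... | suc j  = suc (suc j)

-- A directed closed walk of length k+1: vertices c 0, …, c k with edges
-- c i → c (i+1) and c k → c 0.
DirectedCycle : ∀ {n} → Digraph n → Set
DirectedCycle {n} E = Σ ℕ λ k → Σ (Fin (suc k) → Fin n) λ c → ∀ i → E (c i) (c (next i)) ≡ true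

Acyclic : ∀ {n} → Digraph n → Set
Acyclic E = ¬ DirectedCycle E

InvertibleWith : OrientedGraph → ℕ → Set
InvertibleWith D k = Σ (Vec (VSubset (size D)) k) λ Xs → Acyclic (invertAll Xs (adj D))

IsInv : OrientedGraph → ℕ → Set
IsInv D m = InvertibleWith D m × (∀ k → InvertibleWith D k → m ≤ k)

-- Dijoin D₁ → D₂ on Fin (n₁ + n₂): first n₁ vertices are D₁, the rest D₂,
-- plus all edges from D₁ to D₂.
dijoinAdj : ∀ {n₁ n₂} → Digraph n₁ → Digraph n₂ → Digraph (n₁ + n₂)
dijoinAdj {n₁} E₁ E₂ u v with splitAt n₁ u | splitAt n₁ v
... | inj₁ a | inj₁ b = E₁ a b
... | inj₁ _ | inj₂ _ = true
... | inj₂ _ | inj₁ _ = false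
... | inj₂ a | inj₂ b = E₂ a b

open import Relation.Binary.PropositionalEquality using (refl)

dijoin-noLoop : ∀ (D₁ D₂ : OrientedGraph) u → dijoinAdj (adj D₁) (adj D₂) u u ≡ false
dijoin-noLoop D₁ D₂ u with splitAt (size D₁) u
... | inj₁ a = noLoop D₁ a
... | inj₂ a = noLoop D₂ a

dijoin-antisym : ∀ (D₁ D₂ : OrientedGraph) u v → dijoinAdj (adj D₁) (adj D₂) u v ≡ true
               → dijoinAdj (adj D₁) (adj D₂) v u ≡ false
dijoin-antisym D₁ D₂ u v e with splitAt (size D₁) u | splitAt (size D₁) v
... | inj₁ a | inj₁ b = antisym D₁ a b e
... | inj₁ _ | inj₂ _ = refl
... | inj₂ _ | inj₁ _ with e
...   | ()
dijoin-antisym D₁ D₂ u v e | inj₂ a | inj₂ b = antisym D₂ a b e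

_⇒_ : OrientedGraph → OrientedGraph → OrientedGraph
D₁ ⇒ D₂ = record
  { size = size D₁ + size D₂
  ; adj = dijoinAdj (adj D₁) (adj D₂)
  ; noLoop = dijoin-noLoop D₁ D₂
  ; antisym = dijoin-antisym D₁ D₂ }

{-# OPTIONS --safe #-}
-- Record a family X₁, …, X_k by the labelling φ u = (u ∈ X₁, …, u ∈ X_k) ∈ 𝔽₂ᵏ: inverting the
-- family reverses the arc uv exactly when φ u ∙ φ v = 1, so inv D ≤ k iff some labelling in 𝔽₂ᵏ
-- makes D acyclic.  Take such a labelling of D₁ ⇒ D₂ in 𝔽₂^(k+1), with restrictions x to D₁ and
-- y to D₂.  In the inverted dijoin the arc between u ∈ D₁ and b ∈ D₂ points into D₁ iff
-- x u ∙ y b = 1, so the absence of triangles through b means that D₁ stays acyclic for the form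
-- x u ∙ x v + (x u ∙ y b)(x v ∙ y b); symmetrically for D₂, and the absence of 4-cycles through
-- both sides forbids a 2 × 2 permutation pattern among the x u ∙ y v.  With transvections, which
-- are isometries of 𝔽₂^(k+1), a case analysis on the parities of the labels realises one of these
-- forms by a labelling in 𝔽₂ᵏ, unless D₁ or D₂ is acyclic, which inv D₁ = inv D₂ ≥ 1 excludes.
module Submission where

open import Defs
open import Algebra.Bundles using (CommutativeRing)
open import Data.Bool using (Bool; true; false; not; _∧_; _xor_; if_then_else_)
open import Data.Bool.Properties
  using (∧-comm; ∧-assoc; ∧-idem; ∧-zeroʳ; ∧-identityʳ; ∧-inverseˡ; ∧-distribˡ-xor; ∧-distribʳ-xor;
         xor-assoc; xor-comm; xor-same; xor-identityʳ; xor-∧-commutativeRing; ¬-not)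
  renaming (_≟_ to _≟ᵇ_)
open import Algebra.Properties.CommutativeSemigroup
  (CommutativeRing.+-commutativeSemigroup xor-∧-commutativeRing) using (interchange)
open import Data.Empty using (⊥; ⊥-elim)
open import Data.Fin using (Fin; zero; suc; fromℕ; inject₁; opposite; _↑ˡ_; _↑ʳ_)
open import Data.Fin.Induction using (<-weakInduction; <-weakInduction-startingFrom)
open import Data.Fin.Properties using (opposite-involutive; ≤fromℕ; any?; splitAt-↑ˡ; splitAt-↑ʳ)
open import Data.Nat using (ℕ; zero; suc; _+_; _≤_; _<_)
open import Data.Nat.Properties using (≤-trans; ≤-<-trans; n<1+n)
open import Data.Product using (Σ; ∃; _×_; _,_)
open import Data.Sum using (_⊎_; inj₁; inj₂)
import Data.Sum as Sum
open import Data.Vec using (Vec; []; _∷_; lookup; tabulate)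
open import Data.Vec.Functional using (Vector; map; zipWith; foldr; replicate; removeAt; updateAt; head; tail)
open import Data.Vec.Properties using (lookup∘tabulate)
open import Function using (_∘_; id; const; flip)
open import Relation.Nullary using (¬_; yes; no; Dec)
open import Relation.Nullary.Decidable using (_×-dec_)
open import Relation.Nullary.Negation using (¬∃⟶∀¬)
open import Relation.Binary.PropositionalEquality

private variable
  k m n n₁ n₂ : ℕ

-- Vectors over 𝔽₂

V : ℕ → Set
V = Vector Bool

infixl 8 _⊕_
infixr 9 _⊙_
infix 7 _∙_ _∙[_]_

_⊕_ : V k → V k → V k
_⊕_ = zipWith _xor_

_⊙_ : Bool → V k → V k
α ⊙ z = map (α ∧_) z

0ᵥ 1ᵥ : V k
0ᵥ = replicate _ false
1ᵥ = replicate _ true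

basis : Fin k → V k
basis i = updateAt 0ᵥ i (const true)

_∙_ : V k → V k → Bool
z ∙ w = foldr _xor_ false (zipWith _∧_ z w)

-- For odd c, the Gram form of the projection z ↦ z ⊕ (z ∙ c) ⊙ c onto the orthogonal complement of c.
_∙[_]_ : V k → V k → V k → Bool
z ∙[ c ] w = z ∙ w xor (z ∙ c ∧ w ∙ c)

xor-cancelʳ : ∀ a b → (a xor b) xor b ≡ a
xor-cancelʳ a b = trans (xor-assoc a b b) (trans (cong (a xor_) (xor-same b)) (xor-identityʳ a))

xor-cancelˡ : ∀ a b → (a xor b) xor a ≡ b
xor-cancelˡ a b = trans (cong (_xor a) (xor-comm a b)) (xor-cancelʳ b a)

∙-cong : ∀ {z z′ w w′ : V k} → z ≗ z′ → w ≗ w′ → z ∙ w ≡ z′ ∙ w′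
∙-cong {zero}  _ _ = refl
∙-cong {suc k} p q = cong₂ _xor_ (cong₂ _∧_ (p zero) (q zero)) (∙-cong (p ∘ suc) (q ∘ suc))

∙-comm : (z w : V k) → z ∙ w ≡ w ∙ z
∙-comm {zero}  z w = refl
∙-comm {suc k} z w = cong₂ _xor_ (∧-comm (head z) (head w)) (∙-comm (tail z) (tail w))

∙-distribʳ-⊕ : (z z′ w : V k) → (z ⊕ z′) ∙ w ≡ z ∙ w xor z′ ∙ w
∙-distribʳ-⊕ {zero}  z z′ w = refl
∙-distribʳ-⊕ {suc k} z z′ w =
  trans (cong₂ _xor_ (∧-distribʳ-xor (head w) (head z) (head z′)) (∙-distribʳ-⊕ (tail z) (tail z′) (tail w)))
        (interchange (head z ∧ head w) (head z′ ∧ head w) (tail z ∙ tail w) (tail z′ ∙ tail w))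

⊙-∙ : ∀ α (z w : V k) → (α ⊙ z) ∙ w ≡ α ∧ z ∙ w
⊙-∙ {zero}  α z w = sym (∧-zeroʳ α)
⊙-∙ {suc k} α z w =
  trans (cong₂ _xor_ (∧-assoc α (head z) (head w)) (⊙-∙ α (tail z) (tail w)))
        (sym (∧-distribˡ-xor α _ _))

⊕⊙-∙ : ∀ α (z c w : V k) → (z ⊕ α ⊙ c) ∙ w ≡ z ∙ w xor α ∧ c ∙ w
⊕⊙-∙ α z c w = trans (∙-distribʳ-⊕ z (α ⊙ c) w) (cong (z ∙ w xor_) (⊙-∙ α c w))

⊙-∙-⊙ : ∀ α β (z w : V k) → (α ⊙ z) ∙ (β ⊙ w) ≡ α ∧ β ∧ z ∙ w
⊙-∙-⊙ α β z w = trans (⊙-∙ α z (β ⊙ w))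
  (cong (α ∧_) (trans (∙-comm z (β ⊙ w)) (trans (⊙-∙ β w z) (cong (β ∧_) (∙-comm w z)))))

0ᵥ-∙ : (w : V k) → 0ᵥ ∙ w ≡ false
0ᵥ-∙ {zero}  w = refl
0ᵥ-∙ {suc k} w = 0ᵥ-∙ (tail w)

basis-∙ : (i : Fin k) (w : V k) → basis i ∙ w ≡ w i
basis-∙ zero    w = trans (cong (head w xor_) (0ᵥ-∙ (tail w))) (xor-identityʳ (head w))
basis-∙ (suc i) w = basis-∙ i (tail w)

∙-1ᵥ : (z : V k) → z ∙ 1ᵥ ≡ z ∙ z
∙-1ᵥ {zero}  z = refl
∙-1ᵥ {suc k} z = cong₂ _xor_ (trans (∧-identityʳ (head z)) (sym (∧-idem (head z)))) (∙-1ᵥ (tail z))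

∙-removeAt : (z w : V (suc k)) (i : Fin (suc k)) → removeAt z i ∙ removeAt w i ≡ z ∙ w xor (z i ∧ w i)
∙-removeAt z w zero = sym (xor-cancelˡ (head z ∧ head w) _)
∙-removeAt {suc k} z w (suc i) =
  trans (cong (head z ∧ head w xor_) (∙-removeAt (tail z) (tail w) i))
        (sym (xor-assoc (head z ∧ head w) (tail z ∙ tail w) (z (suc i) ∧ w (suc i))))

basis-diag : (i : Fin k) → basis i i ≡ true
basis-diag zero    = refl
basis-diag (suc i) = basis-diag i

1ᵥ-∙-even : (z : V k) → z ∙ z ≡ false → 1ᵥ ∙ z ≡ false
1ᵥ-∙-even z even = trans (∙-comm 1ᵥ z) (trans (∙-1ᵥ z) even)

∙[]-orthogonal : (z c w : V k) → z ∙ c ≡ false → z ∙[ c ] w ≡ z ∙ w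
∙[]-orthogonal z c w z⊥c = trans (cong (λ b → z ∙ w xor (b ∧ w ∙ c)) z⊥c) (xor-identityʳ (z ∙ w))

∙[]-cong : ∀ {c c′} (z w : V k) → c ≗ c′ → z ∙[ c ] w ≡ z ∙[ c′ ] w
∙[]-cong z w c≗c′ =
  cong₂ (λ p q → z ∙ w xor p ∧ q) (∙-cong {z = z} (λ _ → refl) c≗c′) (∙-cong {z = w} (λ _ → refl) c≗c′)

∙-even-V1 : (z w : V 1) → z ∙ z ≡ false → z ∙ w ≡ false
∙-even-V1 z w z-even = cong (λ b → b ∧ w zero xor false)
  (trans (sym (∧-idem (z zero))) (trans (sym (xor-identityʳ _)) z-even))

⊕1ᵥ-∙ : ∀ α β (z w : V k) → z ∙ z ≡ false → w ∙ w ≡ false →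
        (z ⊕ α ⊙ 1ᵥ) ∙ (w ⊕ β ⊙ 1ᵥ) ≡ z ∙ w xor α ∧ β ∧ 1ᵥ {k} ∙ 1ᵥ
⊕1ᵥ-∙ {k} α β z w z-even w-even = begin
  (z ⊕ α ⊙ 1ᵥ) ∙ w′                    ≡⟨ ⊕⊙-∙ α z 1ᵥ w′ ⟩
  z ∙ w′ xor α ∧ 1ᵥ ∙ w′               ≡⟨ cong₂ (λ p q → p xor α ∧ q) z∙w′ 1ᵥ∙w′ ⟩
  z ∙ w xor α ∧ β ∧ 1ᵥ {k} ∙ 1ᵥ        ∎
  where
  open ≡-Reasoning
  w′ : V k
  w′ = w ⊕ β ⊙ 1ᵥ
  z∙w′ : z ∙ w′ ≡ z ∙ w
  z∙w′ = begin
    z ∙ w′                   ≡⟨ ∙-comm z w′ ⟩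
    w′ ∙ z                   ≡⟨ ⊕⊙-∙ β w 1ᵥ z ⟩
    w ∙ z xor β ∧ 1ᵥ ∙ z     ≡⟨ cong (λ b → w ∙ z xor β ∧ b) (1ᵥ-∙-even z z-even) ⟩
    w ∙ z xor β ∧ false      ≡⟨ cong (w ∙ z xor_) (∧-zeroʳ β) ⟩
    w ∙ z xor false          ≡⟨ xor-identityʳ (w ∙ z) ⟩
    w ∙ z                    ≡⟨ ∙-comm w z ⟩
    z ∙ w                    ∎
  1ᵥ∙w′ : 1ᵥ ∙ w′ ≡ β ∧ 1ᵥ {k} ∙ 1ᵥ
  1ᵥ∙w′ = begin
    1ᵥ ∙ w′                     ≡⟨ ∙-comm 1ᵥ w′ ⟩
    w′ ∙ 1ᵥ                     ≡⟨ ⊕⊙-∙ β w 1ᵥ 1ᵥ ⟩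
    w ∙ 1ᵥ xor β ∧ 1ᵥ {k} ∙ 1ᵥ   ≡⟨ cong (_xor β ∧ 1ᵥ {k} ∙ 1ᵥ) (trans (∙-1ᵥ w) w-even) ⟩
    β ∧ 1ᵥ {k} ∙ 1ᵥ             ∎

transvect : V k → V k → V k
transvect a z = z ⊕ (z ∙ a) ⊙ a

transvect-∙ : (a : V k) → a ∙ a ≡ false → (z w : V k) → transvect a z ∙ transvect a w ≡ z ∙ w
transvect-∙ {k} a isotropic z w = begin
  transvect a z ∙ w′                                   ≡⟨ ⊕⊙-∙ (z ∙ a) z a w′ ⟩
  z ∙ w′ xor z ∙ a ∧ a ∙ w′                            ≡⟨ cong₂ (λ p q → p xor z ∙ a ∧ q) z∙w′ a∙w′ ⟩
  (z ∙ w xor z ∙ a ∧ w ∙ a) xor z ∙ a ∧ w ∙ a          ≡⟨ xor-cancelʳ (z ∙ w) (z ∙ a ∧ w ∙ a) ⟩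
  z ∙ w                                                ∎
  where
  open ≡-Reasoning
  w′ : V k
  w′ = transvect a w
  z∙w′ : z ∙ w′ ≡ z ∙ w xor z ∙ a ∧ w ∙ a
  z∙w′ = begin
    z ∙ w′                      ≡⟨ ∙-comm z w′ ⟩
    w′ ∙ z                      ≡⟨ ⊕⊙-∙ (w ∙ a) w a z ⟩
    w ∙ z xor w ∙ a ∧ a ∙ z     ≡⟨ cong₂ (λ p q → p xor w ∙ a ∧ q) (∙-comm w z) (∙-comm a z) ⟩
    z ∙ w xor w ∙ a ∧ z ∙ a     ≡⟨ cong (z ∙ w xor_) (∧-comm (w ∙ a) (z ∙ a)) ⟩
    z ∙ w xor z ∙ a ∧ w ∙ a     ∎
  a∙w′ : a ∙ w′ ≡ w ∙ a
  a∙w′ = begin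
    a ∙ w′                      ≡⟨ ∙-comm a w′ ⟩
    w′ ∙ a                      ≡⟨ ⊕⊙-∙ (w ∙ a) w a a ⟩
    w ∙ a xor w ∙ a ∧ a ∙ a     ≡⟨ cong (λ b → w ∙ a xor w ∙ a ∧ b) isotropic ⟩
    w ∙ a xor w ∙ a ∧ false     ≡⟨ cong (w ∙ a xor_) (∧-zeroʳ (w ∙ a)) ⟩
    w ∙ a xor false             ≡⟨ xor-identityʳ (w ∙ a) ⟩
    w ∙ a                       ∎

dropOdd : V (suc k) → Fin (suc k) → V (suc k) → V k
dropOdd c i z = removeAt (transvect (c ⊕ basis i) z) i

module _ (c : V (suc k)) (i : Fin (suc k)) (c-odd : c ∙ c ≡ true) (cᵢ≡0 : c i ≡ false) where

  private
    a : V (suc k)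
    a = c ⊕ basis i

    c∙a : c ∙ a ≡ true
    c∙a = begin
      c ∙ a                     ≡⟨ ∙-comm c a ⟩
      a ∙ c                     ≡⟨ ∙-distribʳ-⊕ c (basis i) c ⟩
      c ∙ c xor basis i ∙ c     ≡⟨ cong₂ _xor_ c-odd (trans (basis-∙ i c) cᵢ≡0) ⟩
      true                      ∎
      where open ≡-Reasoning

    a-isotropic : a ∙ a ≡ false
    a-isotropic = begin
      a ∙ a                     ≡⟨ ∙-distribʳ-⊕ c (basis i) a ⟩
      c ∙ a xor basis i ∙ a     ≡⟨ cong₂ _xor_ c∙a (basis-∙ i a) ⟩
      true xor (c i xor basis i i) ≡⟨ cong₂ (λ p q → true xor (p xor q)) cᵢ≡0 (basis-diag i) ⟩
      false                     ∎
      where open ≡-Reasoning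

    transvect-c : transvect a c ≗ basis i
    transvect-c j = begin
      c j xor c ∙ a ∧ a j              ≡⟨ cong (λ b → c j xor b ∧ a j) c∙a ⟩
      c j xor (c j xor basis i j)      ≡⟨ xor-assoc (c j) (c j) (basis i j) ⟨
      (c j xor c j) xor basis i j      ≡⟨ cong (_xor basis i j) (xor-same (c j)) ⟩
      basis i j                        ∎
      where open ≡-Reasoning

    transvect-at : (z : V (suc k)) → transvect a z i ≡ z ∙ c
    transvect-at z = begin
      transvect a z i                     ≡⟨ basis-∙ i (transvect a z) ⟨
      basis i ∙ transvect a z             ≡⟨ ∙-cong {w = transvect a z} (λ j → sym (transvect-c j)) (λ _ → refl) ⟩
      transvect a c ∙ transvect a z       ≡⟨ transvect-∙ a a-isotropic c z ⟩
      c ∙ z                               ≡⟨ ∙-comm c z ⟩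
      z ∙ c                               ∎
      where open ≡-Reasoning

  dropOdd-∙ : (z w : V (suc k)) → dropOdd c i z ∙ dropOdd c i w ≡ z ∙[ c ] w
  dropOdd-∙ z w = begin
    dropOdd c i z ∙ dropOdd c i w
      ≡⟨ ∙-removeAt (transvect a z) (transvect a w) i ⟩
    transvect a z ∙ transvect a w xor transvect a z i ∧ transvect a w i
      ≡⟨ cong₂ (λ p q → p xor q) (transvect-∙ a a-isotropic z w) (cong₂ _∧_ (transvect-at z) (transvect-at w)) ⟩
    z ∙[ c ] w ∎
    where open ≡-Reasoning

-- In odd dimension, complementing an even z when z ∙ c ≡ true makes it orthogonal to the odd vector
-- c ⊕ 1ᵥ, which dropOdd then removes.
dropEven : V (suc k) → Fin (suc k) → V (suc k) → V k
dropEven c q z = dropOdd (c ⊕ 1ᵥ) q (z ⊕ (z ∙ c) ⊙ 1ᵥ)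

dropEven-∙ : (c : V (suc k)) (q : Fin (suc k)) → 1ᵥ {suc k} ∙ 1ᵥ ≡ true → c ∙ c ≡ false → c q ≡ true →
             (z w : V (suc k)) → z ∙ z ≡ false → w ∙ w ≡ false → dropEven c q z ∙ dropEven c q w ≡ z ∙[ c ] w
dropEven-∙ {k} c q n-odd c-even cq≡1 z w z-even w-even = begin
  dropEven c q z ∙ dropEven c q w          ≡⟨ dropOdd-∙ c′ q c′-odd (cong (_xor true) cq≡1) (shift z) (shift w) ⟩
  shift z ∙[ c′ ] shift w                  ≡⟨ ∙[]-orthogonal (shift z) c′ (shift w) (shift-⊥ z z-even) ⟩
  shift z ∙ shift w                        ≡⟨ ⊕1ᵥ-∙ (z ∙ c) (w ∙ c) z w z-even w-even ⟩
  z ∙ w xor z ∙ c ∧ w ∙ c ∧ 1ᵥ {suc k} ∙ 1ᵥ ≡⟨ cong (λ b → z ∙ w xor z ∙ c ∧ w ∙ c ∧ b) n-odd ⟩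
  z ∙ w xor z ∙ c ∧ w ∙ c ∧ true           ≡⟨ cong (λ b → z ∙ w xor z ∙ c ∧ b) (∧-identityʳ (w ∙ c)) ⟩
  z ∙[ c ] w                               ∎
  where
  open ≡-Reasoning
  c′ : V (suc k)
  c′ = c ⊕ 1ᵥ
  shift : V (suc k) → V (suc k)
  shift u = u ⊕ (u ∙ c) ⊙ 1ᵥ
  c′-odd : c′ ∙ c′ ≡ true
  c′-odd = trans (⊕1ᵥ-∙ true true c c c-even c-even) (cong₂ _xor_ c-even n-odd)
  shift-⊥ : (u : V (suc k)) → u ∙ u ≡ false → shift u ∙ c′ ≡ false
  shift-⊥ u u-even = begin
    shift u ∙ c′                                ≡⟨ ⊕1ᵥ-∙ (u ∙ c) true u c u-even c-even ⟩
    u ∙ c xor u ∙ c ∧ true ∧ 1ᵥ {suc k} ∙ 1ᵥ    ≡⟨ cong (λ b → u ∙ c xor u ∙ c ∧ b) n-odd ⟩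
    u ∙ c xor u ∙ c ∧ true                      ≡⟨ cong (u ∙ c xor_) (∧-identityʳ (u ∙ c)) ⟩
    u ∙ c xor u ∙ c                             ≡⟨ xor-same (u ∙ c) ⟩
    false                                       ∎

dropEvenDim : V (suc k) → V k
dropEvenDim z = tail (z ⊕ head z ⊙ 1ᵥ)

dropEvenDim-∙ : 1ᵥ {suc k} ∙ 1ᵥ ≡ false → (z w : V (suc k)) → z ∙ z ≡ false → w ∙ w ≡ false →
                dropEvenDim z ∙ dropEvenDim w ≡ z ∙ w
dropEvenDim-∙ {k} n-even z w z-even w-even = begin
  dropEvenDim z ∙ dropEvenDim w                  ≡⟨ ∙-removeAt (shift z) (shift w) zero ⟩
  shift z ∙ shift w xor head (shift z) ∧ head (shift w)
    ≡⟨ cong (λ b → shift z ∙ shift w xor b ∧ head (shift w)) (head-shift z) ⟩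
  shift z ∙ shift w xor false                    ≡⟨ xor-identityʳ (shift z ∙ shift w) ⟩
  shift z ∙ shift w                              ≡⟨ ⊕1ᵥ-∙ (head z) (head w) z w z-even w-even ⟩
  z ∙ w xor head z ∧ head w ∧ 1ᵥ {suc k} ∙ 1ᵥ     ≡⟨ cong (λ b → z ∙ w xor head z ∧ head w ∧ b) n-even ⟩
  z ∙ w xor head z ∧ head w ∧ false              ≡⟨ cong (λ b → z ∙ w xor head z ∧ b) (∧-zeroʳ (head w)) ⟩
  z ∙ w xor head z ∧ false                       ≡⟨ cong (z ∙ w xor_) (∧-zeroʳ (head z)) ⟩
  z ∙ w xor false                                ≡⟨ xor-identityʳ (z ∙ w) ⟩
  z ∙ w                                          ∎
  where
  open ≡-Reasoning
  shift : V (suc k) → V (suc k)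
  shift u = u ⊕ head u ⊙ 1ᵥ
  head-shift : (u : V (suc k)) → head (shift u) ≡ false
  head-shift u = trans (cong (head u xor_) (∧-identityʳ (head u))) (xor-same (head u))

constant-∙ : ∀ {α β} {z w : V k} → z ≗ α ⊙ 1ᵥ → w ≗ β ⊙ 1ᵥ → z ∙ w ≡ α ∧ β ∧ 1ᵥ {k} ∙ 1ᵥ
constant-∙ {k} {α} {β} p q = trans (∙-cong p q) (⊙-∙-⊙ α β (1ᵥ {k}) 1ᵥ)

-- Closed walks and inversions

next-inject₁ : (i : Fin k) → next (inject₁ i) ≡ suc i
next-inject₁ zero    = refl
next-inject₁ (suc i) rewrite next-inject₁ i = refl

next-fromℕ : ∀ k → next (fromℕ k) ≡ zero
next-fromℕ zero    = refl
next-fromℕ (suc k) rewrite next-fromℕ k = refl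

fromℕ-or-inject₁ : (i : Fin (suc k)) → i ≡ fromℕ k ⊎ ∃ λ j → i ≡ inject₁ j
fromℕ-or-inject₁ {zero}  zero    = inj₁ refl
fromℕ-or-inject₁ {suc k} zero    = inj₂ (zero , refl)
fromℕ-or-inject₁ {suc k} (suc i) with fromℕ-or-inject₁ i
... | inj₁ refl       = inj₁ refl
... | inj₂ (j , refl) = inj₂ (suc j , refl)

opposite-inject₁ : (j : Fin k) → opposite (inject₁ j) ≡ suc (opposite j)
opposite-inject₁ j = begin
  opposite (inject₁ j)                        ≡⟨ cong (opposite ∘ inject₁) (opposite-involutive j) ⟨
  opposite (opposite (suc (opposite j)))      ≡⟨ opposite-involutive (suc (opposite j)) ⟩
  suc (opposite j)                            ∎
  where open ≡-Reasoning

next-opposite-next : (i : Fin (suc k)) → next (opposite (next i)) ≡ opposite i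
next-opposite-next {k} i with fromℕ-or-inject₁ i
... | inj₁ refl rewrite next-fromℕ k | next-fromℕ k = sym (opposite-involutive zero)
... | inj₂ (j , refl) rewrite next-inject₁ j | next-inject₁ (opposite j) = sym (opposite-inject₁ j)

acyclic-comap : {E : Digraph n} {E′ : Digraph m} (f : Fin m → Fin n) →
                (∀ u v → E′ u v ≡ true → E (f u) (f v) ≡ true) → Acyclic E → Acyclic E′
acyclic-comap f hom acyclic (k , c , arc) = acyclic (k , f ∘ c , λ i → hom _ _ (arc i))

acyclic-resp : {E E′ : Digraph n} → (∀ u v → E u v ≡ E′ u v) → Acyclic E → Acyclic E′
acyclic-resp E≗E′ = acyclic-comap id (λ u v → trans (E≗E′ u v))

acyclic-flip : {E : Digraph n} → Acyclic E → Acyclic (flip E)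
acyclic-flip {E = E} acyclic (k , c , arc) = acyclic (k , c ∘ opposite , reversed)
  where
  reversed : ∀ i → E (c (opposite i)) (c (opposite (next i))) ≡ true
  reversed i = subst (λ j → E (c j) (c (opposite (next i))) ≡ true) (next-opposite-next i)
                     (arc (opposite (next i)))

triangle : (E : Digraph n) (p q r : Fin n) → E p q ≡ true → E q r ≡ true → E r p ≡ true → DirectedCycle E
triangle {n} E p q r pq qr rp = 2 , vertex , arc
  where
  vertex : Fin 3 → Fin n
  vertex zero             = p
  vertex (suc zero)       = q
  vertex (suc (suc zero)) = r
  arc : ∀ i → E (vertex i) (vertex (next i)) ≡ true
  arc zero             = pq
  arc (suc zero)       = qr
  arc (suc (suc zero)) = rp

square : (E : Digraph n) (p q r s : Fin n) →
         E p q ≡ true → E q r ≡ true → E r s ≡ true → E s p ≡ true → DirectedCycle E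
square {n} E p q r s pq qr rs sp = 3 , vertex , arc
  where
  vertex : Fin 4 → Fin n
  vertex zero                   = p
  vertex (suc zero)             = q
  vertex (suc (suc zero))       = r
  vertex (suc (suc (suc zero))) = s
  arc : ∀ i → E (vertex i) (vertex (next i)) ≡ true
  arc zero                   = pq
  arc (suc zero)             = qr
  arc (suc (suc zero))       = rs
  arc (suc (suc (suc zero))) = sp

closed-under-next : (f : Fin (suc k) → Bool) → (∀ i → f i ≡ true → f (next i) ≡ true) →
                    ∀ {i} → f i ≡ true → ∀ j → f j ≡ true
closed-under-next {k} f closed {i} fi = <-weakInduction P P-zero step
  where
  P : Fin (suc k) → Set
  P j = f j ≡ true
  step : ∀ j → P (inject₁ j) → P (suc j)
  step j p = subst P (next-inject₁ j) (closed (inject₁ j) p)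
  P-zero : P zero
  P-zero = subst P (next-fromℕ k) (closed (fromℕ k) (<-weakInduction-startingFrom P fi step (≤fromℕ i)))

descent : (f : Fin (suc k) → Bool) →
          (∀ i → f i ≡ true) ⊎ (∀ i → f i ≡ false) ⊎ ∃ λ i → f i ≡ true × f (next i) ≡ false
descent f with any? (λ i → (f i ≟ᵇ true) ×-dec (f (next i) ≟ᵇ false))
... | yes step = inj₂ (inj₂ step)
... | no no-step with any? (λ i → f i ≟ᵇ true)
...   | yes (i , fi) = inj₁ (closed-under-next f (λ j fj → ¬-not (λ fj′ → no-step (j , fj , fj′))) fi)
...   | no none      = inj₂ (inj₁ (λ i → ¬-not (¬∃⟶∀¬ none i)))

invert-inside : ∀ {X : VSubset n} {E u v} → X u ≡ true → X v ≡ true → invert X E u v ≡ E v u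
invert-inside Xu Xv rewrite Xu | Xv = refl

invert-outsideˡ : ∀ {X : VSubset n} {E u v} → X u ≡ false → invert X E u v ≡ E u v
invert-outsideˡ Xu rewrite Xu = refl

invert-outsideʳ : ∀ {X : VSubset n} {E u v} → X v ≡ false → invert X E u v ≡ E u v
invert-outsideʳ {X = X} {u = u} Xv rewrite Xv | ∧-zeroʳ (X u) = refl

invert-acyclic-noLeaving : {X : VSubset n} {E : Digraph n} → Acyclic E →
                           (∀ u v → E u v ≡ true → X u ≡ true → X v ≡ false → ⊥) → Acyclic (invert X E)
invert-acyclic-noLeaving {X = X} {E} acyclic no-leaving (k , c , arc) with descent (X ∘ c)
... | inj₁ inside =
  acyclic-flip {E = E} acyclic
    (k , c , λ i → trans (sym (invert-inside {X = X} {E = E} (inside i) (inside (next i)))) (arc i))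
... | inj₂ (inj₁ outside) =
  acyclic (k , c , λ i → trans (sym (invert-outsideˡ {X = X} {E = E} {v = c (next i)} (outside i))) (arc i))
... | inj₂ (inj₂ (i , inside , outside)) =
  no-leaving _ _ (trans (sym (invert-outsideʳ {X = X} {E = E} {u = c i} outside)) (arc i)) inside outside

invert-acyclic-noEntering : {X : VSubset n} {E : Digraph n} → Acyclic E →
                            (∀ u v → E u v ≡ true → X u ≡ false → X v ≡ true → ⊥) → Acyclic (invert X E)
invert-acyclic-noEntering {X = X} {E} acyclic no-entering =
  acyclic-resp (λ u v → cong (λ b → if b then E v u else E u v) (∧-comm (X v) (X u)))
    (acyclic-flip {E = invert X (flip E)}
      (invert-acyclic-noLeaving (acyclic-flip {E = E} acyclic) (λ u v e Xu Xv → no-entering v u e Xv Xu)))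

-- Families of inversions as labellings

-- invert X E is definitionally invertBy (λ u v → X u ∧ X v) E.
invertBy : (Fin n → Fin n → Bool) → Digraph n → Digraph n
invertBy g E u v = if g u v then E v u else E u v

invertBy-cong : ∀ {g g′ : Fin n → Fin n → Bool} {E} → (∀ u v → g u v ≡ g′ u v) →
                ∀ u v → invertBy g E u v ≡ invertBy g′ E u v
invertBy-cong {E = E} g≗g′ u v = cong (λ b → if b then E v u else E u v) (g≗g′ u v)

invertBy-false : ∀ {g : Fin n → Fin n → Bool} {E} → (∀ u v → g u v ≡ false) →
                 Acyclic (invertBy g E) → Acyclic E
invertBy-false {E = E} g≡false = acyclic-resp (invertBy-cong {E = E} g≡false)

invertBy-invertBy : ∀ {g h : Fin n → Fin n → Bool} {E} → (∀ u v → h u v ≡ h v u) →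
                    ∀ u v → invertBy g (invertBy h E) u v ≡ invertBy (λ u v → h u v xor g u v) E u v
invertBy-invertBy {g = g} {h} h-sym u v rewrite h-sym v u with h u v | g u v
... | false | false = refl
... | false | true  = refl
... | true  | false = refl
... | true  | true  = refl

gram : (Fin n → V k) → Fin n → Fin n → Bool
gram φ u v = φ u ∙ φ v

Decyclable : Digraph n → ℕ → Set
Decyclable {n} E k = Σ (Fin n → V k) λ φ → Acyclic (invertBy (gram φ) E)

decyclableVia : ∀ {g} {E : Digraph n} (ψ : Fin n → V k) → (∀ u v → ψ u ∙ ψ v ≡ g u v) →
                Acyclic (invertBy g E) → Decyclable E k
decyclableVia {E = E} ψ gram≡ acyclic =
  ψ , acyclic-resp (invertBy-cong {E = E} (λ u v → sym (gram≡ u v))) acyclic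

labels : Vec (VSubset n) k → Fin n → V k
labels Xs u i = lookup Xs i u

subsets : (Fin n → V k) → Vec (VSubset n) k
subsets φ = tabulate λ i u → φ u i

invertAll-labels : (Xs : Vec (VSubset n) k) (E : Digraph n) →
                   ∀ u v → invertAll Xs E u v ≡ invertBy (gram (labels Xs)) E u v
invertAll-labels []       E u v = refl
invertAll-labels (X ∷ Xs) E u v =
  trans (invertAll-labels Xs (invert X E) u v)
        (invertBy-invertBy {g = gram (labels Xs)} {E = E} (λ u v → ∧-comm (X u) (X v)) u v)

invertibleWith⇒decyclable : ∀ {D} → InvertibleWith D k → Decyclable (adj D) k
invertibleWith⇒decyclable (Xs , acyclic) = labels Xs , acyclic-resp (invertAll-labels Xs _) acyclic

decyclable⇒invertibleWith : ∀ {D} → Decyclable (adj D) k → InvertibleWith D k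
decyclable⇒invertibleWith {D = D} (φ , acyclic) = subsets φ , acyclic-resp invertAll-subsets acyclic
  where
  labels-subsets : ∀ u → labels (subsets φ) u ≗ φ u
  labels-subsets u i = cong (λ X → X u) (lookup∘tabulate (λ i u → φ u i) i)
  invertAll-subsets : ∀ u v → invertBy (gram φ) (adj D) u v ≡ invertAll (subsets φ) (adj D) u v
  invertAll-subsets u v = sym (trans (invertAll-labels (subsets φ) (adj D) u v)
    (invertBy-cong {E = adj D} (λ u v → ∙-cong (labels-subsets u) (labels-subsets v)) u v))

-- Labellings of a dijoin

-- probe₁ and probe₂ record the absence of triangles through a vertex of the other side, no-switch
-- the absence of 4-cycles alternating between the sides.
record DijoinConstraints (E₁ : Digraph n₁) (E₂ : Digraph n₂) (x : Fin n₁ → V k) (y : Fin n₂ → V k) : Set where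
  field
    acyclic₁  : Acyclic (invertBy (gram x) E₁)
    acyclic₂  : Acyclic (invertBy (gram y) E₂)
    probe₁    : ∀ b → Acyclic (invertBy (λ u v → x u ∙[ y b ] x v) E₁)
    probe₂    : ∀ a → Acyclic (invertBy (λ u v → y u ∙[ x a ] y v) E₂)
    no-switch : ∀ u u′ v v′ → x u ∙ y v ≡ true → x u′ ∙ y v′ ≡ true →
                x u ∙ y v′ ≡ false → x u′ ∙ y v ≡ false → ⊥

open DijoinConstraints

swap : ∀ {E₁ : Digraph n₁} {E₂ : Digraph n₂} {x : Fin n₁ → V k} {y} →
       DijoinConstraints E₁ E₂ x y → DijoinConstraints E₂ E₁ y x
swap {x = x} {y} C = record
  { acyclic₁  = acyclic₂ C
  ; acyclic₂  = acyclic₁ C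
  ; probe₁    = probe₂ C
  ; probe₂    = probe₁ C
  ; no-switch = λ v v′ u u′ p q r s →
      no-switch C u u′ v v′ (comm v u p) (comm v′ u′ q) (comm v′ u s) (comm v u′ r)
  }
  where
  comm : ∀ v u {b} → y v ∙ x u ≡ b → x u ∙ y v ≡ b
  comm v u = trans (∙-comm (x u) (y v))

module Dijoin (E₁ : Digraph n₁) (E₂ : Digraph n₂) (φ : Fin (n₁ + n₂) → V k) where

  L : Fin n₁ → Fin (n₁ + n₂)
  L u = u ↑ˡ n₂

  R : Fin n₂ → Fin (n₁ + n₂)
  R v = n₁ ↑ʳ v

  x : Fin n₁ → V k
  x = φ ∘ L

  y : Fin n₂ → V k
  y = φ ∘ R

  M : Digraph (n₁ + n₂)
  M = invertBy (gram φ) (dijoinAdj E₁ E₂)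

  private
    dijoin-LL : ∀ u v → dijoinAdj E₁ E₂ (L u) (L v) ≡ E₁ u v
    dijoin-LL u v rewrite splitAt-↑ˡ n₁ u n₂ | splitAt-↑ˡ n₁ v n₂ = refl

    dijoin-LR : ∀ u v → dijoinAdj E₁ E₂ (L u) (R v) ≡ true
    dijoin-LR u v rewrite splitAt-↑ˡ n₁ u n₂ | splitAt-↑ʳ n₁ n₂ v = refl

    dijoin-RL : ∀ v u → dijoinAdj E₁ E₂ (R v) (L u) ≡ false
    dijoin-RL v u rewrite splitAt-↑ˡ n₁ u n₂ | splitAt-↑ʳ n₁ n₂ v = refl

    dijoin-RR : ∀ u v → dijoinAdj E₁ E₂ (R u) (R v) ≡ E₂ u v
    dijoin-RR u v rewrite splitAt-↑ʳ n₁ n₂ u | splitAt-↑ʳ n₁ n₂ v = refl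

  M-LL : ∀ u v → M (L u) (L v) ≡ invertBy (gram x) E₁ u v
  M-LL u v = cong₂ (if_then_else_ (gram x u v)) (dijoin-LL v u) (dijoin-LL u v)

  M-RR : ∀ u v → M (R u) (R v) ≡ invertBy (gram y) E₂ u v
  M-RR u v = cong₂ (if_then_else_ (gram y u v)) (dijoin-RR v u) (dijoin-RR u v)

  M-LR : ∀ u v → M (L u) (R v) ≡ not (x u ∙ y v)
  M-LR u v with x u ∙ y v
  ... | false = dijoin-LR u v
  ... | true  = dijoin-RL v u

  M-RL : ∀ v u → M (R v) (L u) ≡ y v ∙ x u
  M-RL v u with y v ∙ x u
  ... | false = dijoin-RL v u
  ... | true  = dijoin-LR u v

  constraints : Acyclic M → DijoinConstraints E₁ E₂ x y
  constraints acyclic = record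
    { acyclic₁ = acyclicˣ ; acyclic₂ = acyclicʸ ; probe₁ = probeˣ ; probe₂ = probeʸ ; no-switch = no-switch′ }
    where
    acyclicˣ : Acyclic (invertBy (gram x) E₁)
    acyclicˣ = acyclic-comap {E = M} L (λ u v → trans (M-LL u v)) acyclic

    acyclicʸ : Acyclic (invertBy (gram y) E₂)
    acyclicʸ = acyclic-comap {E = M} R (λ u v → trans (M-RR u v)) acyclic

    probeˣ : ∀ b → Acyclic (invertBy (λ u v → x u ∙[ y b ] x v) E₁)
    probeˣ b = acyclic-resp
                 (invertBy-invertBy {g = λ u v → x u ∙ y b ∧ x v ∙ y b} {E = E₁} (λ u v → ∙-comm (x u) (x v)))
                 (invert-acyclic-noLeaving {X = λ u → x u ∙ y b} acyclicˣ no-leaving)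
      where
      no-leaving : ∀ u v → invertBy (gram x) E₁ u v ≡ true → x u ∙ y b ≡ true → x v ∙ y b ≡ false → ⊥
      no-leaving u v uv ub vb = acyclic (triangle M (L u) (L v) (R b)
        (trans (M-LL u v) uv) (trans (M-LR v b) (cong not vb)) (trans (M-RL b u) (trans (∙-comm (y b) (x u)) ub)))

    probeʸ : ∀ a → Acyclic (invertBy (λ u v → y u ∙[ x a ] y v) E₂)
    probeʸ a = acyclic-resp
                 (invertBy-invertBy {g = λ u v → y u ∙ x a ∧ y v ∙ x a} {E = E₂} (λ u v → ∙-comm (y u) (y v)))
                 (invert-acyclic-noEntering {X = λ v → y v ∙ x a} acyclicʸ no-entering)
      where
      no-entering : ∀ u v → invertBy (gram y) E₂ u v ≡ true → y u ∙ x a ≡ false → y v ∙ x a ≡ true → ⊥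
      no-entering u v uv ua va = acyclic (triangle M (L a) (R u) (R v)
        (trans (M-LR a u) (cong not (trans (∙-comm (x a) (y u)) ua))) (trans (M-RR u v) uv) (trans (M-RL v a) va))

    no-switch′ : ∀ u u′ v v′ → x u ∙ y v ≡ true → x u′ ∙ y v′ ≡ true →
                 x u ∙ y v′ ≡ false → x u′ ∙ y v ≡ false → ⊥
    no-switch′ u u′ v v′ uv u′v′ uv′ u′v = acyclic (square M (L u) (R v′) (L u′) (R v)
      (trans (M-LR u v′) (cong not uv′)) (trans (M-RL v′ u′) (trans (∙-comm (y v′) (x u′)) u′v′))
      (trans (M-LR u′ v) (cong not u′v)) (trans (M-RL v u) (trans (∙-comm (y v) (x u)) uv)))

-- Lowering the dimension

OddsAllOnes : (Fin n → V k) → Set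
OddsAllOnes z = ∀ u → z u ∙ z u ≡ true → z u ≗ 1ᵥ

Constant : (Fin n → V k) → Set
Constant z = ∀ u → z u ≗ (z u ∙ z u) ⊙ 1ᵥ

oddWithZero? : (z : Fin n → V k) → Dec (∃ λ u → z u ∙ z u ≡ true × ∃ λ i → z u i ≡ false)
oddWithZero? z = any? λ u → (z u ∙ z u ≟ᵇ true) ×-dec any? (λ i → z u i ≟ᵇ false)

evenNonzero? : (z : Fin n → V k) → Dec (∃ λ u → z u ∙ z u ≡ false × ∃ λ i → z u i ≡ true)
evenNonzero? z = any? λ u → (z u ∙ z u ≟ᵇ false) ×-dec any? (λ i → z u i ≟ᵇ true)

odd? : (z : Fin n → V k) → Dec (∃ λ u → z u ∙ z u ≡ true)
odd? z = any? λ u → z u ∙ z u ≟ᵇ true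

oddsAllOnes : {z : Fin n → V k} → ¬ (∃ λ u → z u ∙ z u ≡ true × ∃ λ i → z u i ≡ false) → OddsAllOnes z
oddsAllOnes none u odd i = ¬-not λ zero → none (u , odd , i , zero)

constant : {z : Fin n → V k} → OddsAllOnes z →
           ¬ (∃ λ u → z u ∙ z u ≡ false × ∃ λ i → z u i ≡ true) → Constant z
constant {z = z} ones none u i with z u ∙ z u in parity
... | true  = ones u parity i
... | false = ¬-not λ one → none (u , parity , i , one)

evenDim-oddsAllOnes⇒even : 1ᵥ {k} ∙ 1ᵥ ≢ true → {z : Fin n → V k} → OddsAllOnes z → ∀ u → z u ∙ z u ≡ false
evenDim-oddsAllOnes⇒even n-even ones u =
  ¬-not λ odd → n-even (trans (sym (∙-cong (ones u odd) (ones u odd))) odd)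

constant-decyclable : ∀ {E : Digraph n} {z : Fin n → V m} → 1ᵥ {m} ∙ 1ᵥ ≡ true → Constant z →
                      Acyclic (invertBy (gram z) E) → Decyclable E (suc k)
constant-decyclable {n = n} {m = m} {k = k} {E = E} {z = z} n-odd z-const =
  decyclableVia {E = E} ψ ψ-gram
  where
  e₀ : V (suc k)
  e₀ = basis zero
  ψ : Fin n → V (suc k)
  ψ u = (z u ∙ z u) ⊙ e₀
  ψ-gram : ∀ u v → ψ u ∙ ψ v ≡ z u ∙ z v
  ψ-gram u v = begin
    ψ u ∙ ψ v                             ≡⟨ ⊙-∙-⊙ (z u ∙ z u) (z v ∙ z v) e₀ e₀ ⟩
    z u ∙ z u ∧ z v ∙ z v ∧ e₀ ∙ e₀        ≡⟨ cong (λ b → z u ∙ z u ∧ z v ∙ z v ∧ b) (basis-∙ zero e₀) ⟩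
    z u ∙ z u ∧ z v ∙ z v ∧ true          ≡⟨ cong (λ b → z u ∙ z u ∧ z v ∙ z v ∧ b) n-odd ⟨
    z u ∙ z u ∧ z v ∙ z v ∧ 1ᵥ {m} ∙ 1ᵥ    ≡⟨ constant-∙ (z-const u) (z-const v) ⟨
    z u ∙ z v                             ∎
    where open ≡-Reasoning

zeroOdds : (Fin n → V k) → Fin n → V k
zeroOdds z u = not (z u ∙ z u) ⊙ z u

zeroOdds-even : (z : Fin n → V k) → ∀ u → zeroOdds z u ∙ zeroOdds z u ≡ false
zeroOdds-even z u =
  trans (⊙-∙-⊙ (not p) (not p) (z u) (z u)) (trans (cong (not p ∧_) (∧-inverseˡ p)) (∧-zeroʳ (not p)))
  where
  p : Bool
  p = z u ∙ z u

zeroOdds-∙ : {z : Fin n → V k} → OddsAllOnes z → ∀ u v → zeroOdds z u ∙ zeroOdds z v ≡ z u ∙[ 1ᵥ ] z v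
zeroOdds-∙ {z = z} ones u v = begin
  zeroOdds z u ∙ zeroOdds z v
    ≡⟨ ⊙-∙-⊙ (not (z u ∙ z u)) (not (z v ∙ z v)) (z u) (z v) ⟩
  not (z u ∙ z u) ∧ not (z v ∙ z v) ∧ z u ∙ z v
    ≡⟨ drop-odd ⟩
  z u ∙ z v xor z u ∙ z u ∧ z v ∙ z v
    ≡⟨ cong₂ (λ p q → z u ∙ z v xor p ∧ q) (∙-1ᵥ (z u)) (∙-1ᵥ (z v)) ⟨
  z u ∙[ 1ᵥ ] z v
    ∎
  where
  open ≡-Reasoning
  drop-odd : not (z u ∙ z u) ∧ not (z v ∙ z v) ∧ z u ∙ z v ≡ z u ∙ z v xor z u ∙ z u ∧ z v ∙ z v
  drop-odd with z u ∙ z u in odd-u | z v ∙ z v in odd-v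
  ... | true  | pv    = sym (trans (cong (_xor pv) (trans (∙-cong {w = z v} (ones u odd-u) (λ _ → refl))
                          (trans (∙-comm 1ᵥ (z v)) (trans (∙-1ᵥ (z v)) odd-v)))) (xor-same pv))
  ... | false | true  = sym (trans (xor-identityʳ _) (trans (∙-cong {z = z u} (λ _ → refl) (ones v odd-v))
                          (trans (∙-1ᵥ (z u)) odd-u)))
  ... | false | false = sym (xor-identityʳ _)

constant-∙[1ᵥ] : {z : Fin n → V k} → 1ᵥ {k} ∙ 1ᵥ ≡ true → Constant z → ∀ u v → z u ∙[ 1ᵥ ] z v ≡ false
constant-∙[1ᵥ] {k = k} {z = z} n-odd z-const u v = begin
  z u ∙ z v xor z u ∙ 1ᵥ ∧ z v ∙ 1ᵥ   ≡⟨ cong₂ (λ p q → z u ∙ z v xor p ∧ q) (∙-1ᵥ (z u)) (∙-1ᵥ (z v)) ⟩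
  z u ∙ z v xor pu ∧ pv              ≡⟨ cong (_xor pu ∧ pv) (constant-∙ (z-const u) (z-const v)) ⟩
  (pu ∧ pv ∧ 1ᵥ {k} ∙ 1ᵥ) xor pu ∧ pv ≡⟨ cong (λ b → (pu ∧ pv ∧ b) xor pu ∧ pv) n-odd ⟩
  (pu ∧ pv ∧ true) xor pu ∧ pv       ≡⟨ cong (λ b → (pu ∧ b) xor pu ∧ pv) (∧-identityʳ pv) ⟩
  pu ∧ pv xor pu ∧ pv                ≡⟨ xor-same (pu ∧ pv) ⟩
  false                              ∎
  where
  open ≡-Reasoning
  pu pv : Bool
  pu = z u ∙ z u
  pv = z v ∙ z v

module _ {E₁ : Digraph n₁} {E₂ : Digraph n₂} where

  decyclable₂-constantLabels : {x : Fin n₁ → V (suc k)} {y : Fin n₂ → V (suc k)} → DijoinConstraints E₁ E₂ x y →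
                               1ᵥ {suc k} ∙ 1ᵥ ≡ true → (∀ u → x u ∙ x u ≡ false) → Constant y →
                               ¬ Acyclic E₁ → Decyclable E₂ k
  decyclable₂-constantLabels {zero} {x = x} C _ x-even _ cyclic₁ =
    ⊥-elim (cyclic₁ (invertBy-false {E = E₁} (λ u v → ∙-even-V1 (x u) (x v) (x-even u)) (acyclic₁ C)))
  decyclable₂-constantLabels {suc k} C n-odd _ y-const _ =
    constant-decyclable {E = E₂} n-odd y-const (acyclic₂ C)

  lowerDimension-evenLabels : {x : Fin n₁ → V (suc k)} {y : Fin n₂ → V (suc k)} → DijoinConstraints E₁ E₂ x y →
                              1ᵥ {suc k} ∙ 1ᵥ ≡ true → (∀ u → x u ∙ x u ≡ false) → OddsAllOnes y →
                              ¬ Acyclic E₁ → Decyclable E₁ k ⊎ Decyclable E₂ k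
  lowerDimension-evenLabels {x = x} {y} C n-odd x-even y-ones cyclic₁ with evenNonzero? y
  ... | yes (b , yb-even , q , yb[q]) = inj₁ (decyclableVia {E = E₁} (λ u → dropEven (y b) q (x u))
          (λ u v → dropEven-∙ (y b) q n-odd yb-even yb[q] (x u) (x v) (x-even u) (x-even v)) (probe₁ C b))
  ... | no none = inj₂ (decyclable₂-constantLabels C n-odd x-even (constant y-ones none) cyclic₁)

  -- zeroOdds y replaces the odd labels, all 1ᵥ, by 0ᵥ; this turns the form of probe₂ o₁ into a Gram form.
  -- no-switch makes the even labels orthogonal to x w.
  lowerDimension-oddLabels : {x : Fin n₁ → V (suc k)} {y : Fin n₂ → V (suc k)} → DijoinConstraints E₁ E₂ x y →
                             1ᵥ {suc k} ∙ 1ᵥ ≡ true → OddsAllOnes x → OddsAllOnes y →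
                             ∀ {o₁ o₂} → x o₁ ≗ 1ᵥ → y o₂ ≗ 1ᵥ → ¬ Acyclic E₁ → Decyclable E₂ k
  lowerDimension-oddLabels {x = x} {y} C n-odd x-ones y-ones {o₁} {o₂} x[o₁]≗1 y[o₂]≗1 cyclic₁
    with evenNonzero? x
  ... | yes (w , x[w]-even , q , x[w]q) =
    decyclableVia {E = E₂} (λ v → dropEven (x w) q (zeroOdds y v)) gram-eq (probe₂ C o₁)
    where
    even⊥x[w] : ∀ v → y v ∙ y v ≡ false → y v ∙ x w ≡ false
    even⊥x[w] v even = ¬-not λ odd → no-switch C w o₁ v o₂ (trans (∙-comm (x w) (y v)) odd)
      (trans (∙-cong x[o₁]≗1 y[o₂]≗1) n-odd)
      (trans (∙-cong {z = x w} (λ _ → refl) y[o₂]≗1) (trans (∙-1ᵥ (x w)) x[w]-even))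
      (trans (∙-cong {w = y v} x[o₁]≗1 (λ _ → refl)) (1ᵥ-∙-even (y v) even))

    zeroOdds⊥x[w] : ∀ v → zeroOdds y v ∙ x w ≡ false
    zeroOdds⊥x[w] v = trans (⊙-∙ (not (y v ∙ y v)) (y v) (x w)) (not-∧-vanish (y v ∙ y v) (even⊥x[w] v))
      where
      not-∧-vanish : ∀ p {d} → (p ≡ false → d ≡ false) → not p ∧ d ≡ false
      not-∧-vanish true  _   = refl
      not-∧-vanish false d≡0 = d≡0 refl

    gram-eq : ∀ u v → dropEven (x w) q (zeroOdds y u) ∙ dropEven (x w) q (zeroOdds y v) ≡
                      y u ∙[ x o₁ ] y v
    gram-eq u v = begin
      dropEven (x w) q (zeroOdds y u) ∙ dropEven (x w) q (zeroOdds y v)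
        ≡⟨ dropEven-∙ (x w) q n-odd x[w]-even x[w]q (zeroOdds y u) (zeroOdds y v)
                      (zeroOdds-even y u) (zeroOdds-even y v) ⟩
      zeroOdds y u ∙[ x w ] zeroOdds y v
        ≡⟨ ∙[]-orthogonal (zeroOdds y u) (x w) (zeroOdds y v) (zeroOdds⊥x[w] u) ⟩
      zeroOdds y u ∙ zeroOdds y v      ≡⟨ zeroOdds-∙ y-ones u v ⟩
      y u ∙[ 1ᵥ ] y v                  ≡⟨ ∙[]-cong (y u) (y v) x[o₁]≗1 ⟨
      y u ∙[ x o₁ ] y v                ∎
      where open ≡-Reasoning
  ... | no none = ⊥-elim (cyclic₁ (invertBy-false {E = E₁} vanish (probe₁ C o₂)))
    where
    vanish : ∀ u v → x u ∙[ y o₂ ] x v ≡ false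
    vanish u v = trans (∙[]-cong (x u) (x v) y[o₂]≗1) (constant-∙[1ᵥ] n-odd (constant x-ones none) u v)

module _ {E₁ : Digraph n₁} {E₂ : Digraph n₂} {x : Fin n₁ → V (suc k)} {y : Fin n₂ → V (suc k)}
         (C : DijoinConstraints E₁ E₂ x y) (cyclic₁ : ¬ Acyclic E₁) (cyclic₂ : ¬ Acyclic E₂) where

  lowerDimension-oddsAllOnes : OddsAllOnes x → OddsAllOnes y → Decyclable E₁ k ⊎ Decyclable E₂ k
  lowerDimension-oddsAllOnes x-ones y-ones with 1ᵥ {suc k} ∙ 1ᵥ ≟ᵇ true
  ... | no n-even = inj₁ (decyclableVia {E = E₁} (dropEvenDim ∘ x)
          (λ u v → dropEvenDim-∙ (¬-not n-even) (x u) (x v) (x-even u) (x-even v)) (acyclic₁ C))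
    where
    x-even : ∀ u → x u ∙ x u ≡ false
    x-even = evenDim-oddsAllOnes⇒even n-even x-ones
  ... | yes n-odd with odd? x | odd? y
  ...   | no x-even | _ =
    lowerDimension-evenLabels C n-odd (λ u → ¬-not (¬∃⟶∀¬ x-even u)) y-ones cyclic₁
  ...   | yes _ | no y-even =
    Sum.swap (lowerDimension-evenLabels (swap C) n-odd (λ v → ¬-not (¬∃⟶∀¬ y-even v)) x-ones cyclic₂)
  ...   | yes (o₁ , odd₁) | yes (o₂ , odd₂) =
    inj₂ (lowerDimension-oddLabels C n-odd x-ones y-ones (x-ones o₁ odd₁) (y-ones o₂ odd₂) cyclic₁)

  lowerDimension : Decyclable E₁ k ⊎ Decyclable E₂ k
  lowerDimension with oddWithZero? y | oddWithZero? x
  ... | yes (b , odd , i , yb[i]≡0) | _ = inj₁ (decyclableVia {E = E₁} (λ u → dropOdd (y b) i (x u))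
          (λ u v → dropOdd-∙ (y b) i odd yb[i]≡0 (x u) (x v)) (probe₁ C b))
  ... | no _ | yes (a , odd , i , xa[i]≡0) = inj₂ (decyclableVia {E = E₂} (λ v → dropOdd (x a) i (y v))
          (λ u v → dropOdd-∙ (x a) i odd xa[i]≡0 (y u) (y v)) (probe₂ C a))
  ... | no y-none | no x-none = lowerDimension-oddsAllOnes (oddsAllOnes x-none) (oddsAllOnes y-none)

dijoin-decyclable : ∀ {k′} {E₁ : Digraph n₁} {E₂ : Digraph n₂} → Decyclable (dijoinAdj E₁ E₂) k′ →
                    ¬ Acyclic E₁ → ¬ Acyclic E₂ → ∃ λ k → k < k′ × (Decyclable E₁ k ⊎ Decyclable E₂ k)
-- In dimension 0 every product of labels is false, so acyclic₁ below is acyclicity of E₁ itself.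
dijoin-decyclable {k′ = zero}  {E₁ = E₁} {E₂} (φ , acyclic) cyclic₁ _ =
  ⊥-elim (cyclic₁ (acyclic₁ (Dijoin.constraints E₁ E₂ φ acyclic)))
dijoin-decyclable {k′ = suc k} {E₁ = E₁} {E₂} (φ , acyclic) cyclic₁ cyclic₂ =
  k , n<1+n k , lowerDimension (Dijoin.constraints E₁ E₂ φ acyclic) cyclic₁ cyclic₂

inv-positive⇒cyclic : ∀ {D m} → (∀ k → InvertibleWith D k → m ≤ k) → 1 ≤ m → ¬ Acyclic (adj D)
inv-positive⇒cyclic minimal 1≤m acyclic with ≤-trans 1≤m (minimal 0 ([] , acyclic))
... | ()

theorem1p2 : (D₁ D₂ : OrientedGraph) (m : ℕ) → IsInv D₁ m → IsInv D₂ m → 1 ≤ m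
             → (m' : ℕ) → IsInv (D₁ ⇒ D₂) m' → m < m'
theorem1p2 D₁ D₂ m (_ , minimal₁) (_ , minimal₂) 1≤m m' (invertible , _)
  with dijoin-decyclable {E₁ = adj D₁} {adj D₂} (invertibleWith⇒decyclable {D = D₁ ⇒ D₂} invertible)
         (inv-positive⇒cyclic {D = D₁} minimal₁ 1≤m) (inv-positive⇒cyclic {D = D₂} minimal₂ 1≤m)
... | k , k<m' , inj₁ decyclable₁ = ≤-<-trans (minimal₁ k (decyclable⇒invertibleWith {D = D₁} decyclable₁)) k<m'
... | k , k<m' , inj₂ decyclable₂ = ≤-<-trans (minimal₂ k (decyclable⇒invertibleWith {D = D₂} decyclable₂)) k<m'
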